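{- Let $m\ge2$ and let $a,b$ be non-negative integers with $1+a+b=m$. Consider the triangle in $\mathbb R^3$ with vertices $A=(0,1,0)$, $B=(0,0,1)$, $C=(m,-a,-b)$, and write $a_1=\gcd(m,a)$, $b_1=\gcd(m,b)$. Then there are exactly $1+a_1+b_1$ lattice points of $\mathbb Z^3$ on the sides of triangle $ABC$, and the number $e$ of lattice points in the interior of triangle $ABC$ equals $$e=\frac{m+1-a_1-b_1}{2}.$$
   Context: This triangle arises from a zero-dimensional cyclic quotient singularity $\mathbb A^3/\mu_m$ with action $(x,y,z)\mapsto(\zeta x,\zeta^a y,\zeta^b z)$; the interior lattice points correspond to the exceptional projective planes of its crepant toric resolution. -}

module Defs where

open import Data.Nat using (ℕ)
open import Data.Integer using (ℤ; +_)
open import Data.Rational using (ℚ; 0ℚ; 1ℚ; _+_; _-_; _*_; _≤_; _<_; _/_)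
open import Data.Product using (Σ; _×_; ∃)
open import Data.Sum using (_⊎_)
open import Data.List using (List; length)
open import Data.List.Relation.Unary.Unique.Propositional using (Unique)
open import Data.List.Membership.Propositional using (_∈_)
open import Function.Bundles using (_⇔_)
open import Relation.Binary.PropositionalEquality using (_≡_)

Pt : Set
Pt = ℤ × ℤ × ℤ

ι : ℤ → ℚ
ι k = k / 1

-- (l , u , v) are barycentric coordinates of p w.r.t. the triangle
-- A = (0,1,0), B = (0,0,1), C = (m,-a,-b):  p = l A + u B + v C, l,u,v ≥ 0, l+u+v = 1.
Bary : ℕ → ℕ → ℕ → Pt → ℚ → ℚ → ℚ → Set
Bary m a b (x Data.Product., y Data.Product., z) l u v =
  (0ℚ ≤ l) × (0ℚ ≤ u) × (0ℚ ≤ v) × (l + u + v ≡ 1ℚ)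
  × (ι x ≡ v * ι (+ m))
  × (ι y ≡ l - v * ι (+ a))
  × (ι z ≡ u - v * ι (+ b))

OnSide : ℕ → ℕ → ℕ → Pt → Set
OnSide m a b p = Σ ℚ λ l → Σ ℚ λ u → Σ ℚ λ v →
  Bary m a b p l u v × (l ≡ 0ℚ ⊎ u ≡ 0ℚ ⊎ v ≡ 0ℚ)

Interior : ℕ → ℕ → ℕ → Pt → Set
Interior m a b p = Σ ℚ λ l → Σ ℚ λ u → Σ ℚ λ v →
  Bary m a b p l u v × (0ℚ < l) × (0ℚ < u) × (0ℚ < v)

HasExactly : ℕ → (Pt → Set) → Set
HasExactly N P = Σ (List Pt) λ L → Unique L × (length L ≡ N) × (∀ p → (p ∈ L) ⇔ P p)

module Submission where

-- With c = b + 1, the lattice points of the plane x + y + z = 1 are the points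
-- pt x k = (x, k - x, 1 - k), whose barycentric coordinates are
-- (k m - c x, m + c x - k m - x, x) / m.  So the triangle meets only the columns 0 ≤ x ≤ m;
-- the columns x = 0 and x = m contribute the three vertices, and a column 0 < x < m
-- contains at most the point with k = ⌈c x / m⌉.  Writing r = c x mod m, that point is on
-- BC if r = 0, on CA if r = x, interior if r > x, and missing if 0 < r < x.  Since
-- c x ≡ -a x and c x ≡ x + b x (mod m), the first two cases occur for gcd(m,a) - 1 and
-- gcd(m,b) - 1 columns; and as r(x) + r(m - x) ∈ {0, m}, the reflection x ↦ m - x
-- exchanges the last two cases, so they occur equally often among the m - 1 columns.

open import Data.Nat using (ℕ)

module Sums where

  open import Data.Bool using (Bool; true; false)
  open import Data.List using (List; []; _∷_; length; map; applyUpTo; filter)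
  open import Data.List.Membership.Propositional using (_∈_)
  open import Data.List.Membership.Propositional.Properties using (∈-applyUpTo⁺; ∈-applyUpTo⁻)
  open import Data.List.Properties using (map-applyUpTo)
  open import Data.List.Relation.Unary.Unique.Propositional using (Unique)
  open import Data.List.Relation.Unary.Unique.Propositional.Properties using (applyUpTo⁺₁)
  open import Data.Nat using (zero; suc; _+_; _*_; _∸_; _≤_; s≤s; z≤n; NonZero; >-nonZero; ≢-nonZero; ≢-nonZero⁻¹)
  open import Data.Nat.Coprimality using (Coprime; coprime-/gcd; coprime-divisor)
  open import Data.Nat.Divisibility
  open import Data.Nat.GCD using (gcd; gcd[m,n]∣m; gcd[m,n]∣n; gcd[m,n]≢0)
  open import Data.Nat.ListAction using (sum)
  open import Data.Nat.Properties
  open import Algebra.Properties.CommutativeSemigroup +-commutativeSemigroup using (interchange)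
  open import Data.Product using (_×_; _,_)
  open import Data.Sum using (inj₁)
  open import Function using (_∘_)
  open import Function.Bundles using (_⇔_; mk⇔)
  open import Relation.Binary.PropositionalEquality
  open import Relation.Nullary.Decidable using (does; does-⇔; dec-true; dec-false)
  open import Relation.Unary using (Decidable)
  open ≡-Reasoning

  ∑ : (ℕ → ℕ) → ℕ → ℕ
  ∑ f n = sum (applyUpTo (f ∘ suc) n)

  ∑-cong : ∀ {f g} n → (∀ x → 1 ≤ x → x ≤ n → f x ≡ g x) → ∑ f n ≡ ∑ g n
  ∑-cong zero    f≗g = refl
  ∑-cong (suc n) f≗g =
    cong₂ _+_ (f≗g 1 ≤-refl (s≤s z≤n)) (∑-cong n (λ x _ x≤n → f≗g (suc x) (s≤s z≤n) (s≤s x≤n)))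

  ∑-last : ∀ f n → ∑ f (suc n) ≡ ∑ f n + f (suc n)
  ∑-last f zero    = +-comm (f 1) 0
  ∑-last f (suc n) = trans (cong (f 1 +_) (∑-last (f ∘ suc) n)) (sym (+-assoc (f 1) _ _))

  ∑-split : ∀ f n k → ∑ f (n + k) ≡ ∑ f n + ∑ (λ x → f (n + x)) k
  ∑-split f zero    k = refl
  ∑-split f (suc n) k = trans (cong (f 1 +_) (∑-split (f ∘ suc) n k)) (sym (+-assoc (f 1) _ _))

  ∑-distrib-+ : ∀ f g n → ∑ (λ x → f x + g x) n ≡ ∑ f n + ∑ g n
  ∑-distrib-+ f g zero    = refl
  ∑-distrib-+ f g (suc n) = begin
    (f 1 + g 1) + ∑ (λ x → f (suc x) + g (suc x)) n ≡⟨ cong (f 1 + g 1 +_) (∑-distrib-+ (f ∘ suc) (g ∘ suc) n) ⟩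
    (f 1 + g 1) + (∑ (f ∘ suc) n + ∑ (g ∘ suc) n)   ≡⟨ interchange (f 1) (g 1) _ _ ⟩
    (f 1 + ∑ (f ∘ suc) n) + (g 1 + ∑ (g ∘ suc) n)   ∎

  ∑-const : ∀ k n → ∑ (λ _ → k) n ≡ n * k
  ∑-const k zero    = refl
  ∑-const k (suc n) = cong (k +_) (∑-const k n)

  ∑-reverse : ∀ f n → ∑ f n ≡ ∑ (λ x → f (suc n ∸ x)) n
  ∑-reverse f zero    = refl
  ∑-reverse f (suc n) = begin
    ∑ f (suc n)                                ≡⟨ ∑-last f n ⟩
    ∑ f n + f (suc n)                          ≡⟨ cong (_+ f (suc n)) (∑-reverse f n) ⟩
    ∑ (λ x → f (suc n ∸ x)) n + f (suc n)      ≡⟨ +-comm _ (f (suc n)) ⟩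
    ∑ (λ x → f (suc (suc n) ∸ x)) (suc n)      ∎

  𝟙 : Bool → ℕ
  𝟙 true  = 1
  𝟙 false = 0

  count : (ℕ → Bool) → ℕ → ℕ
  count P = ∑ (𝟙 ∘ P)

  range : ℕ → List ℕ
  range = applyUpTo suc

  ∈-range⇔ : ∀ {n x} → x ∈ range n ⇔ (1 ≤ x × x ≤ n)
  ∈-range⇔ {n} = mk⇔
    (λ x∈ → let i , i<n , x≡1+i = ∈-applyUpTo⁻ suc x∈ in subst (λ x → 1 ≤ x × x ≤ n) (sym x≡1+i) (s≤s z≤n , i<n))
    (λ { (s≤s {n = i} z≤n , i<n) → ∈-applyUpTo⁺ suc i<n })

  unique-range : ∀ n → Unique (range n)
  unique-range n = applyUpTo⁺₁ suc n (λ i<j _ → <⇒≢ i<j ∘ suc-injective)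

  length-filter : ∀ {P : ℕ → Set} (P? : Decidable P) xs → length (filter P? xs) ≡ sum (map (𝟙 ∘ does ∘ P?) xs)
  length-filter P? []       = refl
  length-filter P? (x ∷ xs) with does (P? x)
  ... | true  = cong suc (length-filter P? xs)
  ... | false = length-filter P? xs

  length-filter-range : ∀ {P : ℕ → Set} (P? : Decidable P) n → length (filter P? (range n)) ≡ count (does ∘ P?) n
  length-filter-range P? n = trans (length-filter P? (range n)) (cong sum (map-applyUpTo suc (𝟙 ∘ does ∘ P?) n))

  count-multiples : ∀ d g .{{_ : NonZero d}} → count (λ x → does (d ∣? x)) (g * d) ≡ g
  count-multiples d       zero    = refl
  count-multiples d@(suc d′) (suc g) = begin
    count d∣_ (d + g * d)                              ≡⟨ ∑-split (𝟙 ∘ d∣_) d (g * d) ⟩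
    count d∣_ d + ∑ (λ x → 𝟙 (d∣ (d + x))) (g * d)     ≡⟨ cong₂ _+_ one-below-d shift ⟩
    1 + count d∣_ (g * d)                              ≡⟨ cong suc (count-multiples d g) ⟩
    suc g                                              ∎
    where
    d∣_ : ℕ → Bool
    d∣ x = does (d ∣? x)
    one-below-d : count d∣_ d ≡ 1
    one-below-d = begin
      count d∣_ d             ≡⟨ ∑-last (𝟙 ∘ d∣_) d′ ⟩
      count d∣_ d′ + 𝟙 (d∣ d) ≡⟨ cong₂ _+_ none-below-d (cong 𝟙 (dec-true (d ∣? d) ∣-refl)) ⟩
      1                       ∎
      where
      none-below-d : count d∣_ d′ ≡ 0
      none-below-d = begin
        count d∣_ d′            ≡⟨ ∑-cong d′ (λ x 1≤x x≤d′ → cong 𝟙 (dec-false (d ∣? x) (>⇒∤ {{>-nonZero 1≤x}} (s≤s x≤d′)))) ⟩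
        ∑ (λ _ → 0) d′          ≡⟨ ∑-const 0 d′ ⟩
        d′ * 0                  ≡⟨ *-zeroʳ d′ ⟩
        0                       ∎
    shift : ∑ (λ x → 𝟙 (d∣ (d + x))) (g * d) ≡ count d∣_ (g * d)
    shift = ∑-cong (g * d) (λ x _ _ → cong 𝟙 (does-⇔ (d∣d+x⇔d∣x x) (d ∣? (d + x)) (d ∣? x)))
      where
      d∣d+x⇔d∣x : ∀ x → d ∣ d + x ⇔ d ∣ x
      d∣d+x⇔d∣x x = mk⇔ (λ d∣d+x → ∣m+n∣m⇒∣n d∣d+x ∣-refl) (∣m∣n⇒∣m+n ∣-refl)

  count-∣*≡gcd : ∀ m c .{{_ : NonZero m}} → count (λ x → does (m ∣? c * x)) m ≡ gcd m c
  count-∣*≡gcd m c = begin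
    count (λ x → does (m ∣? c * x)) m      ≡⟨ ∑-cong m (λ x _ _ → cong 𝟙 (does-⇔ (m∣cx⇔d∣x x) (m ∣? c * x) (d ∣? x))) ⟩
    count (λ x → does (d ∣? x)) m          ≡⟨ cong (count (λ x → does (d ∣? x))) (trans m≡d*g (*-comm d g)) ⟩
    count (λ x → does (d ∣? x)) (g * d)    ≡⟨ count-multiples d g ⟩
    g                                      ∎
    where
    g = gcd m c
    instance
      g≢0 : NonZero g
      g≢0 = ≢-nonZero (gcd[m,n]≢0 m c (inj₁ (≢-nonZero⁻¹ m)))
    g∣m = gcd[m,n]∣m m c
    g∣c = gcd[m,n]∣n m c
    d = quotient g∣m
    e = quotient g∣c
    instance
      d≢0 : NonZero d
      d≢0 = quotient≢0 g∣m
    m≡d*g : m ≡ d * g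
    m≡d*g = m∣n⇒n≡quotient*m g∣m
    d⊥e : Coprime d e
    d⊥e = subst₂ Coprime (n/m≡quotient g∣m) (n/m≡quotient g∣c) (coprime-/gcd m c)
    m∣cx⇔d∣x : ∀ x → m ∣ c * x ⇔ d ∣ x
    m∣cx⇔d∣x x = mk⇔ to from
      where
      to : m ∣ c * x → d ∣ x
      to m∣cx = coprime-divisor d⊥e (*-cancelʳ-∣ g (subst₂ _∣_ m≡d*g cx≡ex*g m∣cx))
        where
        cx≡ex*g : c * x ≡ e * x * g
        cx≡ex*g = begin
          c * x       ≡⟨ cong (_* x) (m∣n⇒n≡quotient*m g∣c) ⟩
          e * g * x   ≡⟨ *-assoc e g x ⟩
          e * (g * x) ≡⟨ cong (e *_) (*-comm g x) ⟩
          e * (x * g) ≡⟨ *-assoc e x g ⟨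
          e * x * g   ∎
      from : d ∣ x → m ∣ c * x
      from d∣x = subst₂ _∣_ (sym m≡d*g) (*-comm x c) (*-pres-∣ d∣x g∣c)


module Embedding where

  open import Defs using (ι)
  open import Data.Integer as ℤ using (ℤ; +_; 0ℤ; +≤+; +<+)
  import Data.Integer.Properties as ℤP
  open import Data.Integer.Tactic.RingSolver using (solve-∀)
  import Data.Nat as ℕ
  open import Data.Nat.Coprimality using (1-coprimeTo) renaming (sym to ⊥-sym)
  open import Data.Rational using (ℚ; mkℚ; 0ℚ; _+_; _*_; _≤_; _<_; *≤*; *<*; Positive; NonNegative)
  open import Data.Rational.Properties
  open import Function.Bundles using (_⇔_; mk⇔)
  open import Relation.Binary.PropositionalEquality

  ι≡mkℚ : ∀ k → ι k ≡ mkℚ k 0 (⊥-sym (1-coprimeTo _))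
  ι≡mkℚ k = fromℚᵘ-toℚᵘ (mkℚ k 0 (⊥-sym (1-coprimeTo _)))

  ι-homo-+ : ∀ i j → ι (i ℤ.+ j) ≡ ι i + ι j
  ι-homo-+ i j rewrite ι≡mkℚ i | ι≡mkℚ j = cong ι (sym (cong₂ ℤ._+_ (ℤP.*-identityʳ i) (ℤP.*-identityʳ j)))

  ι-homo-* : ∀ i j → ι (i ℤ.* j) ≡ ι i * ι j
  ι-homo-* i j rewrite ι≡mkℚ i | ι≡mkℚ j = refl

  ι-mono-≤ : ∀ {i j} → i ℤ.≤ j → ι i ≤ ι j
  ι-mono-≤ {i} {j} i≤j rewrite ι≡mkℚ i | ι≡mkℚ j =
    *≤* (subst₂ ℤ._≤_ (sym (ℤP.*-identityʳ i)) (sym (ℤP.*-identityʳ j)) i≤j)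

  ι-cancel-≤ : ∀ {i j} → ι i ≤ ι j → i ℤ.≤ j
  ι-cancel-≤ {i} {j} ιi≤ιj rewrite ι≡mkℚ i | ι≡mkℚ j =
    subst₂ ℤ._≤_ (ℤP.*-identityʳ i) (ℤP.*-identityʳ j) (drop-*≤* ιi≤ιj)

  ι-mono-< : ∀ {i j} → i ℤ.< j → ι i < ι j
  ι-mono-< {i} {j} i<j rewrite ι≡mkℚ i | ι≡mkℚ j =
    *<* (subst₂ ℤ._<_ (sym (ℤP.*-identityʳ i)) (sym (ℤP.*-identityʳ j)) i<j)

  ι-cancel-< : ∀ {i j} → ι i < ι j → i ℤ.< j
  ι-cancel-< {i} {j} ιi<ιj rewrite ι≡mkℚ i | ι≡mkℚ j =
    subst₂ ℤ._<_ (ℤP.*-identityʳ i) (ℤP.*-identityʳ j) (drop-*<* ιi<ιj)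

  ι-injective : ∀ {i j} → ι i ≡ ι j → i ≡ j
  ι-injective {i} {j} ιi≡ιj rewrite ι≡mkℚ i | ι≡mkℚ j = cong ℚ.numerator ιi≡ιj

  module _ (r : ℚ) .{{_ : Positive r}} {q : ℚ} {k : ℤ} (q*r≡ιk : q * r ≡ ι k) where

    private instance
      r≥0 : NonNegative r
      r≥0 = pos⇒nonNeg r

    0≤q⇔0≤k : 0ℚ ≤ q ⇔ 0ℤ ℤ.≤ k
    0≤q⇔0≤k = mk⇔
      (λ 0≤q → ι-cancel-≤ (subst₂ _≤_ (*-zeroˡ r) q*r≡ιk (*-monoʳ-≤-nonNeg r 0≤q)))
      (λ 0≤k → *-cancelʳ-≤-pos r (subst₂ _≤_ (sym (*-zeroˡ r)) (sym q*r≡ιk) (ι-mono-≤ 0≤k)))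

    q≡0⇔k≡0 : q ≡ 0ℚ ⇔ k ≡ 0ℤ
    q≡0⇔k≡0 = mk⇔
      (λ q≡0 → ι-injective (trans (sym q*r≡ιk) (trans (cong (_* r) q≡0) (*-zeroˡ r))))
      (λ k≡0 → *-cancelʳ-≡-pos (trans q*r≡ιk (trans (cong ι k≡0) (sym (*-zeroˡ r)))))
      where
      *-cancelʳ-≡-pos : ∀ {p} → q * r ≡ p * r → q ≡ p
      *-cancelʳ-≡-pos e =
        ≤-antisym (*-cancelʳ-≤-pos r (≤-reflexive e)) (*-cancelʳ-≤-pos r (≤-reflexive (sym e)))

    0<q⇔0<k : 0ℚ < q ⇔ 0ℤ ℤ.< k
    0<q⇔0<k = mk⇔
      (λ 0<q → ι-cancel-< (subst₂ _<_ (*-zeroˡ r) q*r≡ιk (*-monoˡ-<-pos r 0<q)))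
      (λ 0<k → *-cancelʳ-<-nonNeg r (subst₂ _<_ (sym (*-zeroˡ r)) (sym q*r≡ιk) (ι-mono-< 0<k)))

  0≤m-n⇔ : ∀ {p q} → 0ℤ ℤ.≤ + p ℤ.- + q ⇔ q ℕ.≤ p
  0≤m-n⇔ = mk⇔ (λ h → ℤP.drop‿+≤+ (ℤP.0≤i-j⇒j≤i h)) (λ q≤p → ℤP.i≤j⇒0≤j-i (+≤+ q≤p))

  m-n≡0⇔ : ∀ {p q} → + p ℤ.- + q ≡ 0ℤ ⇔ p ≡ q
  m-n≡0⇔ {p} {q} =
    mk⇔ (λ h → ℤP.+-injective (ℤP.i-j≡0⇒i≡j (+ p) (+ q) h)) (λ p≡q → ℤP.i≡j⇒i-j≡0 (cong +_ p≡q))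

  0<m-n⇔ : ∀ {p q} → 0ℤ ℤ.< + p ℤ.- + q ⇔ q ℕ.< p
  0<m-n⇔ {p} {q} = mk⇔
    (λ h → ℤP.drop‿+<+ (subst₂ ℤ._<_ (ℤP.+-identityˡ (+ q)) (i-j+j≡i (+ p) (+ q)) (ℤP.+-monoˡ-< (+ q) h)))
    (λ q<p → subst (ℤ._< + p ℤ.- + q) (ℤP.+-inverseʳ (+ q)) (ℤP.+-monoˡ-< (ℤ.- + q) (+<+ q<p)))
    where
    i-j+j≡i : ∀ i j → i ℤ.- j ℤ.+ j ≡ i
    i-j+j≡i = solve-∀


module Barycentric (a b : ℕ) where

  open import Defs
  open Embedding
  open import Data.Integer as ℤ using (ℤ; +_; 0ℤ; 1ℤ; +≤+)
  import Data.Integer.Properties as ℤP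
  open import Data.Integer.Tactic.RingSolver using (solve-∀)
  open import Data.Nat as ℕ using (suc)
  import Data.Nat.Properties as ℕP
  open import Data.Product using (Σ; ∃₂; _×_; _,_)
  open import Data.Rational using (ℚ; 0ℚ; 1ℚ; 1/_; _+_; _-_; _*_; _≤_; _<_; Positive; NonZero)
  import Data.Rational.Properties as ℚP
  open import Data.Rational.Solver using (module +-*-Solver)
  open import Data.Sum as Sum using (_⊎_)
  open import Function.Bundles using (_⇔_; mk⇔; Equivalence)
  open import Function.Construct.Composition using (_⇔-∘_)
  open import Relation.Binary.PropositionalEquality
  open Equivalence using (to; from)
  open +-*-Solver

  n m c : ℕ
  n = a ℕ.+ b
  m = suc n
  c = suc b

  pt : ℕ → ℕ → Pt
  pt x k = + x , + k ℤ.- + x , 1ℤ ℤ.- + k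

  -- m·l p, m·u p and the first coordinate x of p are m times the barycentric coordinates l, u, v of p
  m·l m·u : Pt → ℤ
  m·l (x , y , _) = + m ℤ.* y ℤ.+ + a ℤ.* x
  m·u (x , _ , z) = + m ℤ.* z ℤ.+ + b ℤ.* x

  M A B : ℚ
  M = ι (+ m)
  A = ι (+ a)
  B = ι (+ b)

  M≡1+A+B : M ≡ 1ℚ + (A + B)
  M≡1+A+B = trans (ι-homo-+ 1ℤ (+ a ℤ.+ + b)) (cong (λ t → 1ℚ + t) (ι-homo-+ (+ a) (+ b)))

  instance
    M>0 : Positive M
    M>0 = subst Positive (sym (ι≡mkℚ (+ m))) _
    M≢0 : NonZero M
    M≢0 = ℚP.pos⇒nonZero M

  _÷M : ℚ → ℚ
  q ÷M = q * 1/ M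

  ÷M-*M : ∀ q → q ÷M * M ≡ q
  ÷M-*M q = trans (ℚP.*-assoc q (1/ M) M) (trans (cong (q *_) (ℚP.*-inverseˡ M)) (ℚP.*-identityʳ q))

  ι-homo-+₃ : ∀ x y z → ι (x ℤ.+ y ℤ.+ z) ≡ ι x + ι y + ι z
  ι-homo-+₃ x y z = trans (ι-homo-+ (x ℤ.+ y) z) (cong (_+ ι z) (ι-homo-+ x y))

  ι-lin : ∀ e i j → ι (+ m ℤ.* i ℤ.+ + e ℤ.* j) ≡ M * ι i + ι (+ e) * ι j
  ι-lin e i j = trans (ι-homo-+ (+ m ℤ.* i) (+ e ℤ.* j)) (cong₂ _+_ (ι-homo-* (+ m) i) (ι-homo-* (+ e) j))

  Bary⇒scaled : ∀ x y z {l u v} → Bary m a b (x , y , z) l u v →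
          x ℤ.+ y ℤ.+ z ≡ 1ℤ × l * M ≡ ι (m·l (x , y , z)) × u * M ≡ ι (m·u (x , y , z)) × v * M ≡ ι x
  Bary⇒scaled x y z {l} {u} {v} (_ , _ , _ , l+u+v≡1 , ιx , ιy , ιz) =
    ι-injective coordinate-sum , scaled l a y ιy , scaled u b z ιz , sym ιx
    where
    scaled : ∀ w e j → ι j ≡ w - v * ι (+ e) → w * M ≡ ι (+ m ℤ.* j ℤ.+ + e ℤ.* x)
    scaled w e j ιj = begin
      w * M
        ≡⟨ solve 4 (λ M E w v → w :* M := M :* (w :- v :* E) :+ E :* (v :* M)) refl M (ι (+ e)) w v ⟩
      M * (w - v * ι (+ e)) + ι (+ e) * (v * M) ≡⟨ cong₂ (λ s t → M * s + ι (+ e) * t) (sym ιj) (sym ιx) ⟩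
      M * ι j + ι (+ e) * ι x                   ≡⟨ ι-lin e j x ⟨
      ι (+ m ℤ.* j ℤ.+ + e ℤ.* x)               ∎
      where open ≡-Reasoning
    coordinate-sum : ι (x ℤ.+ y ℤ.+ z) ≡ 1ℚ
    coordinate-sum = begin
      ι (x ℤ.+ y ℤ.+ z)                  ≡⟨ ι-homo-+₃ x y z ⟩
      ι x + ι y + ι z                    ≡⟨ cong₂ _+_ (cong₂ _+_ ιx ιy) ιz ⟩
      v * M + (l - v * A) + (u - v * B)  ≡⟨ cong (λ M → v * M + (l - v * A) + (u - v * B)) M≡1+A+B ⟩
      v * (1ℚ + (A + B)) + (l - v * A) + (u - v * B)
        ≡⟨ solve 5 (λ A B l u v → v :* (con 1ℚ :+ (A :+ B)) :+ (l :- v :* A) :+ (u :- v :* B) := l :+ u :+ v) refl A B l u v ⟩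
      l + u + v                          ≡⟨ l+u+v≡1 ⟩
      1ℚ                                 ∎
      where open ≡-Reasoning

  scaled⇒Bary : ∀ x y z → x ℤ.+ y ℤ.+ z ≡ 1ℤ →
          0ℤ ℤ.≤ m·l (x , y , z) → 0ℤ ℤ.≤ m·u (x , y , z) → 0ℤ ℤ.≤ x →
          Bary m a b (x , y , z) (ι (m·l (x , y , z)) ÷M) (ι (m·u (x , y , z)) ÷M) (ι x ÷M)
  scaled⇒Bary x y z x+y+z≡1 0≤m·l 0≤m·u 0≤x =
    nonNeg 0≤m·l , nonNeg 0≤m·u , nonNeg 0≤x , coordinate-sum , sym (÷M-*M (ι x)) , unscaled a y , unscaled b z
    where
    open ≡-Reasoning
    nonNeg : ∀ {k} → 0ℤ ℤ.≤ k → 0ℚ ≤ ι k ÷M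
    nonNeg {k} = from (0≤q⇔0≤k M (÷M-*M (ι k)))
    unscaled : ∀ e j → ι j ≡ ι (+ m ℤ.* j ℤ.+ + e ℤ.* x) ÷M - ι x ÷M * ι (+ e)
    unscaled e j = begin
      ι j                                           ≡⟨ ℚP.*-identityʳ (ι j) ⟨
      ι j * 1ℚ                                      ≡⟨ cong (ι j *_) (ℚP.*-inverseʳ M) ⟨
      ι j * (M * 1/ M)
        ≡⟨ solve 5 (λ M E X Y W → Y :* (M :* W) := (M :* Y :+ E :* X) :* W :- X :* W :* E) refl M (ι (+ e)) (ι x) (ι j) (1/ M) ⟩
      (M * ι j + ι (+ e) * ι x) ÷M - ι x ÷M * ι (+ e) ≡⟨ cong (λ t → t ÷M - ι x ÷M * ι (+ e)) (ι-lin e j x) ⟨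
      ι (+ m ℤ.* j ℤ.+ + e ℤ.* x) ÷M - ι x ÷M * ι (+ e) ∎
    ιx+ιy+ιz≡1 : ι x + ι y + ι z ≡ 1ℚ
    ιx+ιy+ιz≡1 = trans (sym (ι-homo-+₃ x y z)) (cong ι x+y+z≡1)
    sum-identity : ∀ M A B X Y Z W → M ≡ 1ℚ + (A + B) →
                   (M * Y + A * X) * W + (M * Z + B * X) * W + X * W ≡ (X + Y + Z) * (M * W)
    sum-identity _ A B X Y Z W refl =
      solve 6 (λ A B X Y Z W → ((con 1ℚ :+ (A :+ B)) :* Y :+ A :* X) :* W :+ ((con 1ℚ :+ (A :+ B)) :* Z :+ B :* X) :* W :+ X :* W
                            := (X :+ Y :+ Z) :* ((con 1ℚ :+ (A :+ B)) :* W)) refl A B X Y Z W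
    coordinate-sum : ι (m·l (x , y , z)) ÷M + ι (m·u (x , y , z)) ÷M + ι x ÷M ≡ 1ℚ
    coordinate-sum = begin
      ι (m·l (x , y , z)) ÷M + ι (m·u (x , y , z)) ÷M + ι x ÷M
        ≡⟨ cong₂ (λ s t → s ÷M + t ÷M + ι x ÷M) (ι-lin a y x) (ι-lin b z x) ⟩
      (M * ι y + A * ι x) ÷M + (M * ι z + B * ι x) ÷M + ι x ÷M
        ≡⟨ sum-identity M A B (ι x) (ι y) (ι z) (1/ M) M≡1+A+B ⟩
      (ι x + ι y + ι z) * (M * 1/ M) ≡⟨ cong₂ _*_ ιx+ιy+ιz≡1 (ℚP.*-inverseʳ M) ⟩
      1ℚ * 1ℚ                        ≡⟨ ℚP.*-identityˡ 1ℚ ⟩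
      1ℚ                             ∎

  m·l-pt : ∀ x k → m·l (pt x k) ≡ + (k ℕ.* m) ℤ.- + (c ℕ.* x)
  m·l-pt x k = trans (identity (+ a) (+ b) (+ k) (+ x)) (sym (cong₂ ℤ._-_ (ℤP.pos-* k m) (ℤP.pos-* c x)))
    where
    identity : ∀ A B K X → (1ℤ ℤ.+ (A ℤ.+ B)) ℤ.* (K ℤ.- X) ℤ.+ A ℤ.* X
                         ≡ K ℤ.* (1ℤ ℤ.+ (A ℤ.+ B)) ℤ.- (1ℤ ℤ.+ B) ℤ.* X
    identity = solve-∀

  m·u-pt : ∀ x k → m·u (pt x k) ≡ + (m ℕ.+ c ℕ.* x) ℤ.- + (k ℕ.* m ℕ.+ x)
  m·u-pt x k = trans (identity (+ a) (+ b) (+ k) (+ x))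
    (sym (cong₂ ℤ._-_ (trans (ℤP.pos-+ m (c ℕ.* x)) (cong (λ t → + m ℤ.+ t) (ℤP.pos-* c x)))
                       (trans (ℤP.pos-+ (k ℕ.* m) x) (cong (ℤ._+ + x) (ℤP.pos-* k m)))))
    where
    identity : ∀ A B K X → (1ℤ ℤ.+ (A ℤ.+ B)) ℤ.* (1ℤ ℤ.- K) ℤ.+ B ℤ.* X
                         ≡ ((1ℤ ℤ.+ (A ℤ.+ B)) ℤ.+ (1ℤ ℤ.+ B) ℤ.* X) ℤ.- (K ℤ.* (1ℤ ℤ.+ (A ℤ.+ B)) ℤ.+ X)
    identity = solve-∀

  pt-sum : ∀ x k → + x ℤ.+ (+ k ℤ.- + x) ℤ.+ (1ℤ ℤ.- + k) ≡ 1ℤ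
  pt-sum x k = identity (+ x) (+ k)
    where
    identity : ∀ X K → X ℤ.+ (K ℤ.- X) ℤ.+ (1ℤ ℤ.- K) ≡ 1ℤ
    identity = solve-∀

  pt-form : ∀ x y z → x ℤ.+ y ℤ.+ z ≡ 1ℤ → 0ℤ ℤ.≤ x → 0ℤ ℤ.≤ m·l (x , y , z) →
            ∃₂ λ x′ k → (x , y , z) ≡ pt x′ k
  pt-form (+ x) y z x+y+z≡1 _ 0≤m·l = x , ℤ.∣ + x ℤ.+ y ∣ , cong₂ _,_ refl (cong₂ _,_ y≡k-x z≡1-k)
    where
    m[x+y]≡m·l+cx : + m ℤ.* (+ x ℤ.+ y) ≡ m·l (+ x , y , z) ℤ.+ + c ℤ.* + x
    m[x+y]≡m·l+cx = identity (+ a) (+ b) (+ x) y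
      where
      identity : ∀ A B X Y → (1ℤ ℤ.+ (A ℤ.+ B)) ℤ.* (X ℤ.+ Y)
                           ≡ (1ℤ ℤ.+ (A ℤ.+ B)) ℤ.* Y ℤ.+ A ℤ.* X ℤ.+ (1ℤ ℤ.+ B) ℤ.* X
      identity = solve-∀
    0≤x+y : 0ℤ ℤ.≤ + x ℤ.+ y
    0≤x+y = ℤP.*-cancelˡ-≤-pos 0ℤ (+ x ℤ.+ y) (+ m)
      (subst₂ ℤ._≤_ (sym (ℤP.*-zeroʳ (+ m))) (sym m[x+y]≡m·l+cx)
        (ℤP.+-mono-≤ 0≤m·l (subst (0ℤ ℤ.≤_) (ℤP.pos-* c x) (+≤+ ℕ.z≤n))))
    k≡x+y : + ℤ.∣ + x ℤ.+ y ∣ ≡ + x ℤ.+ y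
    k≡x+y = ℤP.0≤i⇒+∣i∣≡i 0≤x+y
    y≡k-x : y ≡ + ℤ.∣ + x ℤ.+ y ∣ ℤ.- + x
    y≡k-x = trans (identity (+ x) y) (cong (ℤ._- + x) (sym k≡x+y))
      where
      identity : ∀ X Y → Y ≡ (X ℤ.+ Y) ℤ.- X
      identity = solve-∀
    z≡1-k : z ≡ 1ℤ ℤ.- + ℤ.∣ + x ℤ.+ y ∣
    z≡1-k = trans (identity (+ x) y z) (cong₂ ℤ._-_ x+y+z≡1 (sym k≡x+y))
      where
      identity : ∀ X Y Z → Z ≡ (X ℤ.+ Y ℤ.+ Z) ℤ.- (X ℤ.+ Y)
      identity = solve-∀

  Bary⇒pt : ∀ p {l u v} → Bary m a b p l u v → ∃₂ λ x k → p ≡ pt x k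
  Bary⇒pt (x , y , z) bary@(0≤l , _ , 0≤v , _) =
    let x+y+z≡1 , l*M≡ , _ , v*M≡ = Bary⇒scaled x y z bary
    in pt-form x y z x+y+z≡1 (to (0≤q⇔0≤k M v*M≡) 0≤v) (to (0≤q⇔0≤k M l*M≡) 0≤l)

  module _ {q : ℚ} {i j : ℕ} (q*M≡ι[i-j] : q * M ≡ ι (+ i ℤ.- + j)) where

    0≤q⇔j≤i : 0ℚ ≤ q ⇔ j ℕ.≤ i
    0≤q⇔j≤i = 0≤m-n⇔ ⇔-∘ 0≤q⇔0≤k M q*M≡ι[i-j]

    q≡0⇔i≡j : q ≡ 0ℚ ⇔ i ≡ j
    q≡0⇔i≡j = m-n≡0⇔ ⇔-∘ q≡0⇔k≡0 M q*M≡ι[i-j]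

    0<q⇔j<i : 0ℚ < q ⇔ j ℕ.< i
    0<q⇔j<i = 0<m-n⇔ ⇔-∘ 0<q⇔0<k M q*M≡ι[i-j]

  Coordinates : ℕ → ℕ → ℚ → ℚ → ℚ → Set
  Coordinates x k l u v = l * M ≡ ι (+ (k ℕ.* m) ℤ.- + (c ℕ.* x))
                        × u * M ≡ ι (+ (m ℕ.+ c ℕ.* x) ℤ.- + (k ℕ.* m ℕ.+ x))
                        × v * M ≡ ι (+ x ℤ.- + 0)

  Bary-pt⇒ : ∀ x k {l u v} → Bary m a b (pt x k) l u v → Coordinates x k l u v
  Bary-pt⇒ x k bary =
    let _ , l*M≡ , u*M≡ , v*M≡ = Bary⇒scaled (+ x) (+ k ℤ.- + x) (1ℤ ℤ.- + k) bary
    in trans l*M≡ (cong ι (m·l-pt x k)) , trans u*M≡ (cong ι (m·u-pt x k)) ,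
       trans v*M≡ (cong ι (sym (ℤP.+-identityʳ (+ x))))

  Bary-pt⇐ : ∀ x k → c ℕ.* x ℕ.≤ k ℕ.* m → k ℕ.* m ℕ.+ x ℕ.≤ m ℕ.+ c ℕ.* x →
             Σ ℚ λ l → Σ ℚ λ u → Σ ℚ λ v → Bary m a b (pt x k) l u v × Coordinates x k l u v
  Bary-pt⇐ x k cx≤km km+x≤m+cx =
    ι (m·l (pt x k)) ÷M , ι (m·u (pt x k)) ÷M , ι (+ x) ÷M ,
    scaled⇒Bary (+ x) (+ k ℤ.- + x) (1ℤ ℤ.- + k) (pt-sum x k)
      (subst (0ℤ ℤ.≤_) (sym (m·l-pt x k)) (from 0≤m-n⇔ cx≤km))
      (subst (0ℤ ℤ.≤_) (sym (m·u-pt x k)) (from 0≤m-n⇔ km+x≤m+cx)) (+≤+ ℕ.z≤n) ,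
    trans (÷M-*M _) (cong ι (m·l-pt x k)) , trans (÷M-*M _) (cong ι (m·u-pt x k)) ,
    trans (÷M-*M _) (cong ι (sym (ℤP.+-identityʳ (+ x))))

  -- the conditions l ≥ 0, u ≥ 0 and (l = 0 or u = 0 or v = 0), resp. l, u, v > 0, at the point pt x k
  OnBoundary Inside : ℕ → ℕ → Set
  OnBoundary x k = c ℕ.* x ℕ.≤ k ℕ.* m × k ℕ.* m ℕ.+ x ℕ.≤ m ℕ.+ c ℕ.* x
                 × (k ℕ.* m ≡ c ℕ.* x ⊎ m ℕ.+ c ℕ.* x ≡ k ℕ.* m ℕ.+ x ⊎ x ≡ 0)
  Inside x k = c ℕ.* x ℕ.< k ℕ.* m × k ℕ.* m ℕ.+ x ℕ.< m ℕ.+ c ℕ.* x × 0 ℕ.< x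

  OnSide-pt⇔ : ∀ x k → OnSide m a b (pt x k) ⇔ OnBoundary x k
  OnSide-pt⇔ x k = mk⇔ to′ from′
    where
    to′ : OnSide m a b (pt x k) → OnBoundary x k
    to′ (_ , _ , _ , bary@(0≤l , 0≤u , _) , some-zero) =
      let l*M≡ , u*M≡ , v*M≡ = Bary-pt⇒ x k bary
      in to (0≤q⇔j≤i l*M≡) 0≤l , to (0≤q⇔j≤i u*M≡) 0≤u ,
         Sum.map (to (q≡0⇔i≡j l*M≡)) (Sum.map (to (q≡0⇔i≡j u*M≡)) (to (q≡0⇔i≡j v*M≡))) some-zero
    from′ : OnBoundary x k → OnSide m a b (pt x k)
    from′ (cx≤km , km+x≤m+cx , some-zero) =
      let l , u , v , bary , l*M≡ , u*M≡ , v*M≡ = Bary-pt⇐ x k cx≤km km+x≤m+cx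
      in l , u , v , bary ,
         Sum.map (from (q≡0⇔i≡j l*M≡)) (Sum.map (from (q≡0⇔i≡j u*M≡)) (from (q≡0⇔i≡j v*M≡))) some-zero

  Interior-pt⇔ : ∀ x k → Interior m a b (pt x k) ⇔ Inside x k
  Interior-pt⇔ x k = mk⇔ to′ from′
    where
    to′ : Interior m a b (pt x k) → Inside x k
    to′ (_ , _ , _ , bary , 0<l , 0<u , 0<v) =
      let l*M≡ , u*M≡ , v*M≡ = Bary-pt⇒ x k bary
      in to (0<q⇔j<i l*M≡) 0<l , to (0<q⇔j<i u*M≡) 0<u , to (0<q⇔j<i v*M≡) 0<v
    from′ : Inside x k → Interior m a b (pt x k)
    from′ (cx<km , km+x<m+cx , 0<x) =
      let l , u , v , bary , l*M≡ , u*M≡ , v*M≡ = Bary-pt⇐ x k (ℕP.<⇒≤ cx<km) (ℕP.<⇒≤ km+x<m+cx)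
      in l , u , v , bary , from (0<q⇔j<i l*M≡) cx<km , from (0<q⇔j<i u*M≡) km+x<m+cx , from (0<q⇔j<i v*M≡) 0<x

  OnSide⇔ : ∀ p → OnSide m a b p ⇔ (∃₂ λ x k → p ≡ pt x k × OnBoundary x k)
  OnSide⇔ p = mk⇔ to′ (λ { (x , k , refl , h) → from (OnSide-pt⇔ x k) h })
    where
    to′ : OnSide m a b p → ∃₂ λ x k → p ≡ pt x k × OnBoundary x k
    to′ h@(_ , _ , _ , bary , _) =
      let x , k , p≡pt = Bary⇒pt p bary in x , k , p≡pt , to (OnSide-pt⇔ x k) (subst (OnSide m a b) p≡pt h)

  Interior⇔ : ∀ p → Interior m a b p ⇔ (∃₂ λ x k → p ≡ pt x k × Inside x k)
  Interior⇔ p = mk⇔ to′ (λ { (x , k , refl , h) → from (Interior-pt⇔ x k) h })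
    where
    to′ : Interior m a b p → ∃₂ λ x k → p ≡ pt x k × Inside x k
    to′ h@(_ , _ , _ , bary , _) =
      let x , k , p≡pt = Bary⇒pt p bary in x , k , p≡pt , to (Interior-pt⇔ x k) (subst (Interior m a b) p≡pt h)

module Columns (a b : ℕ) where

  open Sums
  open Barycentric a b using (n; m; c; pt; OnBoundary; Inside; OnSide⇔; Interior⇔)
  open import Data.Bool using (if_then_else_)
  open import Data.Empty using (⊥; ⊥-elim)
  import Data.Integer.Properties as ℤP
  open import Data.List using (List; []; _∷_; _++_; map; filter; length)
  open import Data.List.Membership.Propositional using (_∈_)
  open import Data.List.Membership.Propositional.Properties using (∈-map∘filter⁻; ∈-map∘filter⁺; ∈-++⁻; ∈-++⁺ˡ; ∈-++⁺ʳ)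
  open import Data.List.Properties using (length-map; length-++)
  open import Data.List.Relation.Binary.Disjoint.Propositional using (Disjoint)
  open import Data.List.Relation.Unary.All using ([]; _∷_)
  open import Data.List.Relation.Unary.AllPairs using ([]; _∷_)
  open import Data.List.Relation.Unary.Any using (here; there)
  open import Data.List.Relation.Unary.Unique.Propositional using (Unique)
  open import Data.List.Relation.Unary.Unique.Propositional.Properties using (map⁺; filter⁺; ++⁺)
  open import Data.Nat using (zero; suc; _+_; _*_; _∸_; _≤_; _<_; s≤s; z≤n; _%_; _/_; _≟_; _<?_)
  open import Data.Nat.DivMod using (m≡m%n+[m/n]*n; m%n<n; [m+kn]%n≡m%n; m<n⇒m%n≡m)
  open import Data.Nat.Divisibility using (_∣_; divides; _∣?_; m%n≡0⇒n∣m; n∣m⇒m%n≡0; ∣m+n∣m⇒∣n; m∣m*n; n∣m*n)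
  open import Data.Nat.GCD using (gcd)
  open import Data.Nat.Properties
  open import Algebra.Properties.CommutativeSemigroup +-commutativeSemigroup using (interchange)
  open import Data.Nat.Tactic.RingSolver using (solve-∀)
  open import Data.Product using (_×_; _,_; ∃; ∃₂; proj₁)
  open import Data.Sum using (_⊎_; inj₁; inj₂; [_,_]′)
  open import Defs using (Pt; OnSide; Interior)
  open import Function using (_∘_)
  open import Function.Bundles using (_⇔_; mk⇔; Equivalence)
  open import Relation.Binary using (tri<; tri≈; tri>)
  open import Relation.Binary.PropositionalEquality
  open import Relation.Nullary.Decidable using (does; does-⇔; dec-true; dec-false; _×-dec_)
  open import Relation.Unary using (Decidable)
  open Equivalence using (to; from)

  m+n+o≡m+[o+n] : ∀ m n o → m + n + o ≡ m + (o + n)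
  m+n+o≡m+[o+n] m n o = trans (+-assoc m n o) (cong (m +_) (+-comm n o))

  r q : ℕ → ℕ
  r x = c * x % m
  q x = c * x / m

  cx≡r+qm : ∀ x → c * x ≡ r x + q x * m
  cx≡r+qm x = m≡m%n+[m/n]*n (c * x) m

  r<m : ∀ x → r x < m
  r<m x = m%n<n (c * x) m

  height : ℕ → ℕ
  height x = if does (r x ≟ 0) then q x else suc (q x)

  height-r≡0 : ∀ x → r x ≡ 0 → height x ≡ q x
  height-r≡0 x r≡0 = cong (if_then q x else suc (q x)) (dec-true (r x ≟ 0) r≡0)

  height-r>0 : ∀ x → 0 < r x → height x ≡ suc (q x)
  height-r>0 x r>0 = cong (if_then q x else suc (q x)) (dec-false (r x ≟ 0) (>⇒≢ r>0))

  closed⇒height : ∀ x k → x < m → c * x ≤ k * m → k * m + x ≤ m + c * x →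
                  (k ≡ q x × r x ≡ 0) ⊎ (k ≡ suc (q x) × x ≤ r x)
  closed⇒height x k x<m cx≤km km+x≤m+cx with m≤n⇒m<n∨m≡n q≤k
    where
    q≤k : q x ≤ k
    q≤k = *-cancelʳ-≤ (q x) k m (≤-trans (m≤n+m (q x * m) (r x)) (subst (_≤ k * m) (cx≡r+qm x) cx≤km))
  ... | inj₂ refl = inj₁ (refl , n≤0⇒n≡0 (+-cancelʳ-≤ (q x * m) (r x) 0 (subst (_≤ q x * m) (cx≡r+qm x) cx≤km)))
  ... | inj₁ q<k = inj₂ (k≡1+q , x≤r)
    where
    k<2+q : k < suc (suc (q x))
    k<2+q = *-cancelʳ-< m k (suc (suc (q x))) (begin-strict
      k * m               ≤⟨ m≤m+n (k * m) x ⟩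
      k * m + x           ≤⟨ km+x≤m+cx ⟩
      m + c * x           ≡⟨ cong (m +_) (cx≡r+qm x) ⟩
      m + (r x + q x * m) <⟨ +-monoʳ-< m (+-monoˡ-< (q x * m) (r<m x)) ⟩
      m + (m + q x * m)   ∎)
      where open ≤-Reasoning
    k≡1+q : k ≡ suc (q x)
    k≡1+q = ≤-antisym (≤-pred k<2+q) q<k
    x≤r : x ≤ r x
    x≤r = +-cancelʳ-≤ (q x * m) x (r x) (+-cancelˡ-≤ m _ _ (begin
      m + (x + q x * m)   ≡⟨ m+n+o≡m+[o+n] m (q x * m) x ⟨
      suc (q x) * m + x   ≡⟨ cong (λ k → k * m + x) k≡1+q ⟨
      k * m + x           ≤⟨ km+x≤m+cx ⟩
      m + c * x           ≡⟨ cong (m +_) (cx≡r+qm x) ⟩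
      m + (r x + q x * m) ∎))
      where open ≤-Reasoning

  OnBC OnCA Inner Empty : ℕ → Set
  OnBC  x = r x ≡ 0
  OnCA  x = 0 < r x × r x ≡ x
  Inner x = x < r x
  Empty x = 0 < r x × r x < x

  onBC? : Decidable OnBC
  onBC? x = r x ≟ 0
  onCA? : Decidable OnCA
  onCA? x = (0 <? r x) ×-dec (r x ≟ x)
  inner? : Decidable Inner
  inner? x = x <? r x
  empty? : Decidable Empty
  empty? x = (0 <? r x) ×-dec (r x <? x)

  closed⇒x≤m : ∀ x k → c * x ≤ k * m → k * m + x ≤ m + c * x → x ≤ m
  closed⇒x≤m x k cx≤km km+x≤m+cx = +-cancelʳ-≤ (c * x) x m (begin
    x + c * x ≤⟨ +-monoʳ-≤ x cx≤km ⟩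
    x + k * m ≡⟨ +-comm x (k * m) ⟩
    k * m + x ≤⟨ km+x≤m+cx ⟩
    m + c * x ∎)
    where open ≤-Reasoning

  onBC⇒boundary : ∀ x → x ≤ n → OnBC x → OnBoundary x (height x)
  onBC⇒boundary x x≤n r≡0 =
    subst (OnBoundary x) (sym (height-r≡0 x r≡0)) (≤-reflexive (sym qm≡cx) , qm+x≤m+cx , inj₁ qm≡cx)
    where
    qm≡cx : q x * m ≡ c * x
    qm≡cx = sym (trans (cx≡r+qm x) (cong (_+ q x * m) r≡0))
    qm+x≤m+cx : q x * m + x ≤ m + c * x
    qm+x≤m+cx = subst₂ _≤_ (+-comm x (q x * m)) (cong (m +_) qm≡cx) (+-monoˡ-≤ (q x * m) (m≤n⇒m≤1+n x≤n))

  onCA⇒boundary : ∀ x → x ≤ n → OnCA x → OnBoundary x (height x)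
  onCA⇒boundary x x≤n (r>0 , r≡x) = subst (OnBoundary x) (sym (height-r>0 x r>0)) (
    subst (_≤ suc (q x) * m) (sym cx≡x+qm) (+-monoˡ-≤ (q x * m) (m≤n⇒m≤1+n x≤n)) ,
    ≤-reflexive (sym boundary-eq) , inj₂ (inj₁ boundary-eq))
    where
    cx≡x+qm : c * x ≡ x + q x * m
    cx≡x+qm = trans (cx≡r+qm x) (cong (_+ q x * m) r≡x)
    boundary-eq : m + c * x ≡ suc (q x) * m + x
    boundary-eq = trans (cong (m +_) cx≡x+qm) (sym (m+n+o≡m+[o+n] m (q x * m) x))

  inner⇒inside : ∀ x → 1 ≤ x → Inner x → Inside x (height x)
  inner⇒inside x 1≤x x<r = subst (Inside x) (sym (height-r>0 x (<-trans 1≤x x<r))) (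
    subst (_< suc (q x) * m) (sym (cx≡r+qm x)) (+-monoˡ-< (q x * m) (r<m x)) ,
    subst₂ _<_ (sym (m+n+o≡m+[o+n] m (q x * m) x)) (cong (m +_) (sym (cx≡r+qm x)))
      (+-monoʳ-< m (+-monoˡ-< (q x * m) x<r)) ,
    1≤x)

  closed-at-0⇒k≤1 : ∀ k → k * m + 0 ≤ m + c * 0 → k ≤ 1
  closed-at-0⇒k≤1 k km+0≤m+c0 = *-cancelʳ-≤ k 1 m (subst₂ _≤_ (+-identityʳ (k * m)) m+c0≡1m km+0≤m+c0)
    where
    m+c0≡1m : m + c * 0 ≡ 1 * m
    m+c0≡1m = cong (m +_) (*-zeroʳ c)

  closed-at-m⇒k≡c : ∀ k → c * m ≤ k * m → k * m + m ≤ m + c * m → k ≡ c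
  closed-at-m⇒k≡c k cm≤km km+m≤m+cm = ≤-antisym
    (*-cancelʳ-≤ k c m (+-cancelʳ-≤ m (k * m) (c * m) (subst (k * m + m ≤_) (+-comm m (c * m)) km+m≤m+cm)))
    (*-cancelʳ-≤ c k m cm≤km)

  m+cx≡⇒r≡x : ∀ x → m + c * x ≡ suc (q x) * m + x → r x ≡ x
  m+cx≡⇒r≡x x e = +-cancelʳ-≡ (q x * m) (r x) x (+-cancelˡ-≡ m _ _ (begin
    m + (r x + q x * m) ≡⟨ cong (m +_) (cx≡r+qm x) ⟨
    m + c * x           ≡⟨ e ⟩
    suc (q x) * m + x   ≡⟨ m+n+o≡m+[o+n] m (q x * m) x ⟩
    m + (x + q x * m)   ∎))
    where open ≡-Reasoning

  boundary⇒ : ∀ x k → OnBoundary x k →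
              (x ≡ 0 × (k ≡ 0 ⊎ k ≡ 1)) ⊎ (x ≡ m × k ≡ c) ⊎ (1 ≤ x × x ≤ n × (OnBC x ⊎ OnCA x) × k ≡ height x)
  boundary⇒ zero k (_ , km+0≤m+c0 , _) with closed-at-0⇒k≤1 k km+0≤m+c0
  ... | z≤n       = inj₁ (refl , inj₁ refl)
  ... | s≤s z≤n   = inj₁ (refl , inj₂ refl)
  boundary⇒ x@(suc _) k (cx≤km , km+x≤m+cx , some-zero) with m≤n⇒m<n∨m≡n (closed⇒x≤m x k cx≤km km+x≤m+cx)
  ... | inj₂ refl = inj₂ (inj₁ (refl , closed-at-m⇒k≡c k cx≤km km+x≤m+cx))
  ... | inj₁ x<m with closed⇒height x k x<m cx≤km km+x≤m+cx
  ...   | inj₁ (refl , r≡0) = inj₂ (inj₂ (s≤s z≤n , ≤-pred x<m , inj₁ r≡0 , sym (height-r≡0 x r≡0)))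
  ...   | inj₂ (refl , x≤r) = inj₂ (inj₂ (s≤s z≤n , ≤-pred x<m , inj₂ (r>0 , r≡x) , sym (height-r>0 x r>0)))
    where
    r>0 : 0 < r x
    r>0 = ≤-trans (s≤s z≤n) x≤r
    r≡x : r x ≡ x
    r≡x = [ (λ km≡cx → ⊥-elim (<⇒≢ (r<m x) (sym (+-cancelʳ-≡ (q x * m) m (r x) (trans km≡cx (cx≡r+qm x))))))
          , [ m+cx≡⇒r≡x x , (λ ()) ]′ ]′ some-zero

  inside⇒ : ∀ x k → Inside x k → 1 ≤ x × x ≤ n × Inner x × k ≡ height x
  inside⇒ x k (cx<km , km+x<m+cx , 0<x) with m≤n⇒m<n∨m≡n (closed⇒x≤m x k (<⇒≤ cx<km) (<⇒≤ km+x<m+cx))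
  ... | inj₂ refl = ⊥-elim (<-irrefl (cong (_* m) (sym (closed-at-m⇒k≡c k (<⇒≤ cx<km) (<⇒≤ km+x<m+cx)))) cx<km)
  ... | inj₁ x<m with closed⇒height x k x<m (<⇒≤ cx<km) (<⇒≤ km+x<m+cx)
  ...   | inj₁ (refl , r≡0) = ⊥-elim (<-irrefl (trans (cx≡r+qm x) (cong (_+ q x * m) r≡0)) cx<km)
  ...   | inj₂ (refl , _) = 0<x , ≤-pred x<m , x<r , sym (height-r>0 x (<-trans 0<x x<r))
    where
    x<r : x < r x
    x<r = +-cancelʳ-< (q x * m) x (r x) (+-cancelˡ-< m _ _ (begin-strict
      m + (x + q x * m)   ≡⟨ m+n+o≡m+[o+n] m (q x * m) x ⟨
      suc (q x) * m + x   <⟨ km+x<m+cx ⟩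
      m + c * x           ≡⟨ cong (m +_) (cx≡r+qm x) ⟩
      m + (r x + q x * m) ∎))
      where open ≤-Reasoning

  column-partition : ∀ x → 1 ≤ x →
    𝟙 (does (onBC? x)) + 𝟙 (does (onCA? x)) + 𝟙 (does (inner? x)) + 𝟙 (does (empty? x)) ≡ 1
  column-partition x 1≤x = exactly-one (r x)
    where
    exactly-one : ∀ ρ → 𝟙 (does (ρ ≟ 0)) + 𝟙 (does ((0 <? ρ) ×-dec (ρ ≟ x)))
                      + 𝟙 (does (x <? ρ)) + 𝟙 (does ((0 <? ρ) ×-dec (ρ <? x))) ≡ 1
    exactly-one zero = refl
    exactly-one ρ@(suc _) with <-cmp ρ x
    ... | tri< ρ<x ρ≢x ρ≯x rewrite dec-false (ρ ≟ x) ρ≢x | dec-false (x <? ρ) ρ≯x | dec-true (ρ <? x) ρ<x = refl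
    ... | tri≈ ρ≮x ρ≡x ρ≯x rewrite dec-true (ρ ≟ x) ρ≡x | dec-false (x <? ρ) ρ≯x | dec-false (ρ <? x) ρ≮x = refl
    ... | tri> ρ≮x ρ≢x ρ>x rewrite dec-false (ρ ≟ x) ρ≢x | dec-true (x <? ρ) ρ>x | dec-false (ρ <? x) ρ≮x = refl

  onBC⇔m∣ax : ∀ x → OnBC x ⇔ m ∣ a * x
  onBC⇔m∣ax x = mk⇔
    (λ r≡0 → ∣m+n∣m⇒∣n m∣cx+ax (m%n≡0⇒n∣m (c * x) m r≡0))
    (λ m∣ax → n∣m⇒m%n≡0 (c * x) m (∣m+n∣m⇒∣n (subst (m ∣_) (+-comm (c * x) (a * x)) m∣cx+ax) m∣ax))
    where
    cx+ax≡mx : c * x + a * x ≡ m * x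
    cx+ax≡mx = trans (sym (*-distribʳ-+ x c a)) (cong (_* x) (cong suc (+-comm b a)))
    m∣cx+ax : m ∣ c * x + a * x
    m∣cx+ax = subst (m ∣_) (sym cx+ax≡mx) (m∣m*n x)

  onCA⇔m∣bx : ∀ x → 1 ≤ x → x < m → OnCA x ⇔ m ∣ b * x
  onCA⇔m∣bx x 1≤x x<m = mk⇔
    (λ (_ , r≡x) → divides (q x) (+-cancelˡ-≡ x (b * x) (q x * m) (trans (cx≡r+qm x) (cong (_+ q x * m) r≡x))))
    (λ m∣bx → let r≡x = r≡x⇐m∣bx m∣bx in subst (0 <_) (sym r≡x) 1≤x , r≡x)
    where
    r≡x⇐m∣bx : m ∣ b * x → r x ≡ x
    r≡x⇐m∣bx (divides t bx≡tm) = trans (cong (λ y → (x + y) % m) bx≡tm) (trans ([m+kn]%n≡m%n x t m) (m<n⇒m%n≡m x<m))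

  mirror-residues : ∀ x → x ≤ m → r x + r (m ∸ x) ≡ 0 ⊎ r x + r (m ∸ x) ≡ m
  mirror-residues x x≤m with m∣r+r′
    where
    x′ = m ∸ x
    m∣r+r′ : m ∣ r x + r x′
    m∣r+r′ = ∣m+n∣m⇒∣n (subst (m ∣_) residues-sum (m∣m*n c)) (n∣m*n (q x + q x′))
      where
      residues-sum : m * c ≡ (q x + q x′) * m + (r x + r x′)
      residues-sum = begin
        m * c                                 ≡⟨ *-comm m c ⟩
        c * m                                 ≡⟨ cong (c *_) (m+[n∸m]≡n x≤m) ⟨
        c * (x + x′)                          ≡⟨ *-distribˡ-+ c x x′ ⟩
        c * x + c * x′                        ≡⟨ cong₂ _+_ (cx≡r+qm x) (cx≡r+qm x′) ⟩
        (r x + q x * m) + (r x′ + q x′ * m)   ≡⟨ interchange (r x) (q x * m) (r x′) (q x′ * m) ⟩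
        (r x + r x′) + (q x * m + q x′ * m)   ≡⟨ +-comm (r x + r x′) _ ⟩
        (q x * m + q x′ * m) + (r x + r x′)   ≡⟨ cong (_+ (r x + r x′)) (*-distribʳ-+ m (q x) (q x′)) ⟨
        (q x + q x′) * m + (r x + r x′)       ∎
        where open ≡-Reasoning
  ... | divides zero          r+r′≡0  = inj₁ r+r′≡0
  ... | divides (suc zero)    r+r′≡m  = inj₂ (trans r+r′≡m (+-identityʳ m))
  ... | divides (suc (suc t)) r+r′≡tm = ⊥-elim (<-irrefl refl (begin-strict
    m + m                    ≤⟨ +-monoʳ-≤ m (m≤m+n m (t * m)) ⟩
    suc (suc t) * m          ≡⟨ r+r′≡tm ⟨
    r x + r (m ∸ x)          <⟨ +-mono-< (r<m x) (r<m (m ∸ x)) ⟩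
    m + m                    ∎))
    where open ≤-Reasoning

  empty⇔inner-mirror : ∀ x → x ≤ m → Empty x ⇔ Inner (m ∸ x)
  empty⇔inner-mirror x x≤m = mk⇔ to′ from′
    where
    x′ = m ∸ x
    x+x′≡m : x + x′ ≡ m
    x+x′≡m = m+[n∸m]≡n x≤m
    r+r′≡x+x′ : r x + r x′ ≢ 0 → r x + r x′ ≡ x + x′
    r+r′≡x+x′ r+r′≢0 =
      [ ⊥-elim ∘ r+r′≢0 , (λ r+r′≡m → trans r+r′≡m (sym x+x′≡m)) ]′ (mirror-residues x x≤m)
    swap-< : ∀ {i i′ j j′} → i + i′ ≡ j + j′ → i < j → j′ < i′
    swap-< {i} {i′} {j} {j′} i+i′≡j+j′ i<j = +-cancelˡ-< j j′ i′ (subst (_< j + i′) i+i′≡j+j′ (+-monoˡ-< i′ i<j))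
    to′ : Empty x → Inner x′
    to′ (r>0 , r<x) = swap-< (r+r′≡x+x′ (>⇒≢ r>0 ∘ m+n≡0⇒m≡0 (r x))) r<x
    from′ : Inner x′ → Empty x
    from′ x′<r′ = r>0 , swap-< (trans (+-comm x′ x) (trans (sym r+r′≡) (+-comm (r x) (r x′)))) x′<r′
      where
      r+r′≡ : r x + r x′ ≡ x + x′
      r+r′≡ = r+r′≡x+x′ (>⇒≢ (≤-<-trans z≤n x′<r′) ∘ m+n≡0⇒n≡0 (r x))
      r>0 : 0 < r x
      r>0 = ≤∧≢⇒< z≤n (λ 0≡r → <⇒≢ (r<m x′) (trans (cong (_+ r x′) 0≡r) (trans r+r′≡ x+x′≡m)))

  #_ : ∀ {P : ℕ → Set} → Decidable P → ℕ
  # P? = count (does ∘ P?) n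

  gcd≡1+# : ∀ e {P : ℕ → Set} (P? : Decidable P) →
            (∀ x → 1 ≤ x → x ≤ n → P x ⇔ m ∣ e * x) → gcd m e ≡ suc (# P?)
  gcd≡1+# e P? P⇔m∣ex = begin
    gcd m e                                                   ≡⟨ count-∣*≡gcd m e ⟨
    count (λ x → does (m ∣? e * x)) m                         ≡⟨ ∑-last (λ x → 𝟙 (does (m ∣? e * x))) n ⟩
    count (λ x → does (m ∣? e * x)) n + 𝟙 (does (m ∣? e * m))
      ≡⟨ cong₂ _+_ (∑-cong n same-below-m) (cong 𝟙 (dec-true (m ∣? e * m) (n∣m*n e))) ⟩
    # P? + 1                                                  ≡⟨ +-comm (# P?) 1 ⟩
    suc (# P?)                                                ∎
    where
    open ≡-Reasoning
    same-below-m : ∀ x → 1 ≤ x → x ≤ n → 𝟙 (does (m ∣? e * x)) ≡ 𝟙 (does (P? x))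
    same-below-m x 1≤x x≤n = cong 𝟙 (sym (does-⇔ (P⇔m∣ex x 1≤x x≤n) (P? x) (m ∣? e * x)))

  gcd[m,a]≡1+#onBC : gcd m a ≡ suc (# onBC?)
  gcd[m,a]≡1+#onBC = gcd≡1+# a onBC? (λ x _ _ → onBC⇔m∣ax x)

  gcd[m,b]≡1+#onCA : gcd m b ≡ suc (# onCA?)
  gcd[m,b]≡1+#onCA = gcd≡1+# b onCA? (λ x 1≤x x≤n → onCA⇔m∣bx x 1≤x (s≤s x≤n))

  #empty≡#inner : # empty? ≡ # inner?
  #empty≡#inner = begin
    count (does ∘ empty?) n
      ≡⟨ ∑-cong n (λ x _ x≤n → cong 𝟙 (does-⇔ (empty⇔inner-mirror x (m≤n⇒m≤1+n x≤n)) (empty? x) (inner? (m ∸ x)))) ⟩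
    ∑ (λ x → 𝟙 (does (inner? (m ∸ x)))) n       ≡⟨ ∑-reverse (𝟙 ∘ does ∘ inner?) n ⟨
    count (does ∘ inner?) n                     ∎
    where open ≡-Reasoning

  #-partition : # onBC? + # onCA? + # inner? + # empty? ≡ n
  #-partition = begin
    # onBC? + # onCA? + # inner? + # empty?     ≡⟨ cong (λ s → s + # inner? + # empty?) (∑-distrib-+ (𝟙 ∘ does ∘ onBC?) (𝟙 ∘ does ∘ onCA?) n) ⟨
    ∑ (λ x → 𝟙 (does (onBC? x)) + 𝟙 (does (onCA? x))) n + # inner? + # empty?
      ≡⟨ cong (_+ # empty?) (∑-distrib-+ (λ x → 𝟙 (does (onBC? x)) + 𝟙 (does (onCA? x))) (𝟙 ∘ does ∘ inner?) n) ⟨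
    ∑ (λ x → 𝟙 (does (onBC? x)) + 𝟙 (does (onCA? x)) + 𝟙 (does (inner? x))) n + # empty?
      ≡⟨ ∑-distrib-+ (λ x → 𝟙 (does (onBC? x)) + 𝟙 (does (onCA? x)) + 𝟙 (does (inner? x))) (𝟙 ∘ does ∘ empty?) n ⟨
    ∑ (λ x → 𝟙 (does (onBC? x)) + 𝟙 (does (onCA? x)) + 𝟙 (does (inner? x)) + 𝟙 (does (empty? x))) n
      ≡⟨ ∑-cong n (λ x 1≤x _ → column-partition x 1≤x) ⟩
    ∑ (λ _ → 1) n                               ≡⟨ ∑-const 1 n ⟩
    n * 1                                       ≡⟨ *-identityʳ n ⟩
    n                                           ∎
    where open ≡-Reasoning

  columnPoint : ℕ → Pt
  columnPoint x = pt x (height x)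

  columnPoints : ∀ {P : ℕ → Set} → Decidable P → List Pt
  columnPoints P? = map columnPoint (filter P? (range n))

  ∈-columnPoints⇔ : ∀ {P : ℕ → Set} (P? : Decidable P) {p} →
                    p ∈ columnPoints P? ⇔ (∃ λ x → (1 ≤ x × x ≤ n) × P x × p ≡ columnPoint x)
  ∈-columnPoints⇔ P? = mk⇔
    (λ p∈ → let x , x∈ , p≡ , Px = ∈-map∘filter⁻ columnPoint P? p∈ in x , to ∈-range⇔ x∈ , Px , p≡)
    (λ (x , bounds , Px , p≡) → ∈-map∘filter⁺ columnPoint P? (x , from ∈-range⇔ bounds , p≡ , Px))

  columnPoint-injective : ∀ {x y} → columnPoint x ≡ columnPoint y → x ≡ y
  columnPoint-injective e = ℤP.+-injective (cong proj₁ e)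

  unique-columnPoints : ∀ {P : ℕ → Set} (P? : Decidable P) → Unique (columnPoints P?)
  unique-columnPoints P? = map⁺ columnPoint-injective (filter⁺ P? (unique-range n))

  length-columnPoints : ∀ {P : ℕ → Set} (P? : Decidable P) → length (columnPoints P?) ≡ # P?
  length-columnPoints P? = trans (length-map columnPoint (filter P? (range n))) (length-filter-range P? n)

  vertices boundaryPoints interiorPoints : List Pt
  vertices       = pt 0 0 ∷ pt 0 1 ∷ pt m c ∷ []
  boundaryPoints = vertices ++ columnPoints onBC? ++ columnPoints onCA?
  interiorPoints = columnPoints inner?

  vertex-boundary : ∀ {p} → p ∈ vertices → ∃₂ λ x k → p ≡ pt x k × OnBoundary x k
  vertex-boundary (here p≡B) = 0 , 0 , p≡B , ≤-reflexive (*-zeroʳ c) , z≤n , inj₂ (inj₂ refl)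
  vertex-boundary (there (here p≡A)) =
    0 , 1 , p≡A , subst (_≤ 1 * m) (sym (*-zeroʳ c)) z≤n , ≤-reflexive (sym m+c0≡1m+0) , inj₂ (inj₂ refl)
    where
    m+c0≡1m+0 : m + c * 0 ≡ 1 * m + 0
    m+c0≡1m+0 = trans (cong (m +_) (*-zeroʳ c)) (cong (_+ 0) (sym (*-identityˡ m)))
  vertex-boundary (there (there (here p≡C))) = m , c , p≡C , ≤-refl , ≤-reflexive (+-comm (c * m) m) , inj₁ refl

  vertex∉columnPoints : ∀ {P : ℕ → Set} (P? : Decidable P) {p} → p ∈ vertices → p ∈ columnPoints P? → ⊥
  vertex∉columnPoints P? p∈V p∈col with to (∈-columnPoints⇔ P?) p∈col
  ... | x , (1≤x , x≤n) , _ , p≡ with p∈V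
  ...   | here p≡B                 = <⇒≢ 1≤x (sym (ℤP.+-injective (cong proj₁ (trans (sym p≡) p≡B))))
  ...   | there (here p≡A)         = <⇒≢ 1≤x (sym (ℤP.+-injective (cong proj₁ (trans (sym p≡) p≡A))))
  ...   | there (there (here p≡C)) = <⇒≢ (s≤s x≤n) (ℤP.+-injective (cong proj₁ (trans (sym p≡) p≡C)))

  onBC-onCA-disjoint : Disjoint (columnPoints onBC?) (columnPoints onCA?)
  onBC-onCA-disjoint (p∈BC , p∈CA) with to (∈-columnPoints⇔ onBC?) p∈BC | to (∈-columnPoints⇔ onCA?) p∈CA
  ... | x , _ , r≡0 , p≡x | y , _ , (r>0 , _) , p≡y
    rewrite columnPoint-injective {x} {y} (trans (sym p≡x) p≡y) = >⇒≢ r>0 r≡0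

  unique-boundaryPoints : Unique boundaryPoints
  unique-boundaryPoints = ++⁺ unique-vertices
    (++⁺ (unique-columnPoints onBC?) (unique-columnPoints onCA?) onBC-onCA-disjoint)
    (λ (p∈V , p∈cols) →
       [ vertex∉columnPoints onBC? p∈V , vertex∉columnPoints onCA? p∈V ]′ (∈-++⁻ (columnPoints onBC?) p∈cols))
    where
    unique-vertices : Unique vertices
    unique-vertices = ((λ ()) ∷ (λ ()) ∷ []) ∷ ((λ ()) ∷ []) ∷ [] ∷ []

  ∈-boundaryPoints⇔ : ∀ p → p ∈ boundaryPoints ⇔ OnSide m a b p
  ∈-boundaryPoints⇔ p = mk⇔ (λ p∈ → from (OnSide⇔ p) (boundary p∈)) (λ h → member (to (OnSide⇔ p) h))
    where
    column-boundary : ∀ {P : ℕ → Set} (P? : Decidable P) → (∀ x → x ≤ n → P x → OnBoundary x (height x)) →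
                      p ∈ columnPoints P? → ∃₂ λ x k → p ≡ pt x k × OnBoundary x k
    column-boundary P? P⇒boundary p∈ =
      let x , (_ , x≤n) , Px , p≡ = to (∈-columnPoints⇔ P?) p∈ in x , height x , p≡ , P⇒boundary x x≤n Px
    boundary : p ∈ boundaryPoints → ∃₂ λ x k → p ≡ pt x k × OnBoundary x k
    boundary p∈ with ∈-++⁻ vertices p∈
    ... | inj₁ p∈V = vertex-boundary p∈V
    ... | inj₂ p∈cols with ∈-++⁻ (columnPoints onBC?) p∈cols
    ...   | inj₁ p∈BC = column-boundary onBC? onBC⇒boundary p∈BC
    ...   | inj₂ p∈CA = column-boundary onCA? onCA⇒boundary p∈CA
    member : (∃₂ λ x k → p ≡ pt x k × OnBoundary x k) → p ∈ boundaryPoints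
    member (x , k , p≡ , bd) with boundary⇒ x k bd
    ... | inj₁ (refl , inj₁ refl)   = here p≡
    ... | inj₁ (refl , inj₂ refl)   = there (here p≡)
    ... | inj₂ (inj₁ (refl , refl)) = there (there (here p≡))
    ... | inj₂ (inj₂ (1≤x , x≤n , inj₁ BC , refl)) =
      ∈-++⁺ʳ vertices (∈-++⁺ˡ (from (∈-columnPoints⇔ onBC?) (x , (1≤x , x≤n) , BC , p≡)))
    ... | inj₂ (inj₂ (1≤x , x≤n , inj₂ CA , refl)) =
      ∈-++⁺ʳ vertices (∈-++⁺ʳ (columnPoints onBC?) (from (∈-columnPoints⇔ onCA?) (x , (1≤x , x≤n) , CA , p≡)))

  ∈-interiorPoints⇔ : ∀ p → p ∈ interiorPoints ⇔ Interior m a b p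
  ∈-interiorPoints⇔ p = mk⇔
    (λ p∈ → let x , (1≤x , _) , x<r , p≡ = to (∈-columnPoints⇔ inner?) p∈
            in from (Interior⇔ p) (x , height x , p≡ , inner⇒inside x 1≤x x<r))
    (λ h → let x , k , p≡ , ins = to (Interior⇔ p) h
               1≤x , x≤n , x<r , k≡h = inside⇒ x k ins
           in from (∈-columnPoints⇔ inner?) (x , (1≤x , x≤n) , x<r , trans p≡ (cong (pt x) k≡h)))

  length-boundaryPoints : length boundaryPoints ≡ 1 + gcd m a + gcd m b
  length-boundaryPoints = begin
    3 + length (columnPoints onBC? ++ columnPoints onCA?)  ≡⟨ cong (3 +_) (length-++ (columnPoints onBC?)) ⟩
    3 + (length (columnPoints onBC?) + length (columnPoints onCA?))
      ≡⟨ cong (3 +_) (cong₂ _+_ (length-columnPoints onBC?) (length-columnPoints onCA?)) ⟩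
    3 + (# onBC? + # onCA?)                                ≡⟨ identity (# onBC?) (# onCA?) ⟩
    1 + suc (# onBC?) + suc (# onCA?)                      ≡⟨ cong₂ (λ g g′ → 1 + g + g′) gcd[m,a]≡1+#onBC gcd[m,b]≡1+#onCA ⟨
    1 + gcd m a + gcd m b                                  ∎
    where
    open ≡-Reasoning
    identity : ∀ i j → 3 + (i + j) ≡ 1 + suc i + suc j
    identity = solve-∀

  2#inner+gcds≡m+1 : 2 * # inner? + gcd m a + gcd m b ≡ m + 1
  2#inner+gcds≡m+1 = begin
    2 * # inner? + gcd m a + gcd m b                        ≡⟨ cong₂ (λ g g′ → 2 * # inner? + g + g′) gcd[m,a]≡1+#onBC gcd[m,b]≡1+#onCA ⟩
    2 * # inner? + suc (# onBC?) + suc (# onCA?)            ≡⟨ identity (# onBC?) (# onCA?) (# inner?) ⟩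
    suc (# onBC? + # onCA? + # inner? + # inner?) + 1       ≡⟨ cong (λ e → suc (# onBC? + # onCA? + # inner? + e) + 1) #empty≡#inner ⟨
    suc (# onBC? + # onCA? + # inner? + # empty?) + 1       ≡⟨ cong (λ s → suc s + 1) #-partition ⟩
    m + 1                                                   ∎
    where
    open ≡-Reasoning
    identity : ∀ i j k → 2 * k + suc i + suc j ≡ suc (i + j + k + k) + 1
    identity = solve-∀

open import Defs
open import Data.Nat using (ℕ; _+_; _*_; _≤_)
open import Data.Nat.GCD using (gcd)
open import Data.Product using (Σ; _×_; _,_)
open import Relation.Binary.PropositionalEquality using (_≡_; refl)

lemma6p10 : (m a b : ℕ) → 2 ≤ m → 1 + a + b ≡ m →
    HasExactly (1 + gcd m a + gcd m b) (OnSide m a b)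
    × Σ ℕ (λ e → HasExactly e (Interior m a b) × (2 * e + gcd m a + gcd m b ≡ m + 1))
lemma6p10 m a b _ refl =
  (boundaryPoints , unique-boundaryPoints , length-boundaryPoints , ∈-boundaryPoints⇔) ,
  # inner? , (interiorPoints , unique-columnPoints inner? , length-columnPoints inner? , ∈-interiorPoints⇔) ,
  2#inner+gcds≡m+1
  where open Columns a b
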